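{- Over the binary alphabet $\Sigma=\{a,b\}$, for every $n\in\omega$, $[B_{n+1}]'=[B_n]$.
   Context: $\Sigma^*$ (resp. $\Sigma^\omega$) is the set of finite (resp. infinite) words over $\Sigma=\{a,b\}$; $\Sigma^\omega$ has the product topology with $\Sigma$ discrete, and subsets carry the subspace topology. $\varepsilon$ is the empty word, $uL=\{uv\mid v\in L\}$. The map $\perp$ swaps letters $a\leftrightarrow b$ and is extended letterwise to words and to languages. For a tree $T$ (prefix-closed subset of $\Sigma^*$), $[T]=\{w\in\Sigma^\omega\mid\forall n,\ w_{\mid n}\in T\}$ with $w_{\mid n}$ the length-$n$ prefix. The trees $B_n$ are defined by $B_0=\emptyset$ and $B_{n+1}=\bigcup_{k\in\omega}a^k(\{\varepsilon\}\cup bB_n^\perp)$. For a topological space $X$, $X'=X\setminus\{x\in X\mid\{x\}\text{ open in }X\}$ (Cantor-Bendixson derivative). -}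

module Defs where

open import Data.Nat using (ℕ; zero; suc)
open import Data.List using (List; []; _∷_; _++_; map; replicate; applyUpTo)
open import Data.Product using (Σ; _×_; ∃)
open import Relation.Nullary using (¬_)
open import Relation.Binary.PropositionalEquality using (_≡_)

data Letter : Set where
  a b : Letter

swap : Letter → Letter
swap a = b
swap b = a

_⊥ʷ : List Letter → List Letter
u ⊥ʷ = map swap u

Word∞ : Set
Word∞ = ℕ → Letter

prefix : Word∞ → ℕ → List Letter
prefix w n = applyUpTo w n

Lang : Set₁
Lang = List Letter → Set

Subset∞ : Set₁
Subset∞ = Word∞ → Set

_≈ω_ : Word∞ → Word∞ → Set
x ≈ω y = ∀ i → x i ≡ y i

[_] : Lang → Subset∞
[ T ] w = ∀ n → T (prefix w n)

-- The trees B_n: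
-- B_0 = ∅,  B_{n+1} = ⋃_k a^k ({ε} ∪ b B_n^⊥),
-- where B_n^⊥ = { u^⊥ | u ∈ B_n }.
data B : ℕ → Lang where
  aᵏ     : ∀ {n} (k : ℕ) → B (suc n) (replicate k a)
  aᵏb⊥   : ∀ {n} (k : ℕ) (u : List Letter) → B n u →
           B (suc n) (replicate k a ++ (b ∷ (u ⊥ʷ)))

-- {x} is open in the subspace X ⊆ Σ^ω (product topology, Σ discrete):
-- some basic open cylinder { y | y|n = x|n } meets X exactly in {x}.
IsolatedIn : Subset∞ → Word∞ → Set
IsolatedIn X x = X x × ∃ λ (n : ℕ) → ∀ y → X y → prefix y n ≡ prefix x n → y ≈ω x

_′ : Subset∞ → Subset∞
(X ′) x = X x × ¬ IsolatedIn X x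

_≐_ : Subset∞ → Subset∞ → Set
X ≐ Y = ∀ w → (X w → Y w) × (Y w → X w)

{-# OPTIONS --safe #-}
-- A finite word lies in B n iff it has fewer than n letter changes when read after an
-- initial a, so [B n] consists of the infinite words with fewer than n changes. A word
-- with fewer than n changes is the limit of its prefixes continued by a constant a or a
-- constant b; both continuations add at most one change, so it is not isolated in
-- [B (n+1)]. Conversely, once a prefix of a word of [B (n+1)] has n changes, every word
-- of [B (n+1)] through that prefix must repeat its last letter forever, so the prefix
-- isolates the word.
module Submission where

open import Defs
open import Data.Nat using (ℕ; zero; suc; _+_; _≤_; _<_; z≤n; s≤s; s≤s⁻¹; _<?_)
open import Data.Nat.Properties
  using (≤-refl; ≤-trans; ≤-reflexive; +-assoc; +-comm; +-identityʳ; +-monoʳ-≤; +-cancelˡ-≤;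
         m+n≤o⇒m≤o; m+n≤o⇒n≤o; n≤0⇒n≡0; ≮⇒≥)
open import Data.List using (List; []; _∷_; _++_; replicate; length)
open import Data.List.Properties using (++-identityʳ; map-∘; map-cong; map-id; length-applyUpTo)
open import Data.Product using (_,_)
open import Function using (const; _∘_)
open import Relation.Nullary using (¬_)
open import Relation.Nullary.Decidable using (decidable-stable)
open import Relation.Binary.PropositionalEquality
  using (_≡_; _≢_; refl; sym; trans; cong; cong₂; subst; module ≡-Reasoning)

open ≡-Reasoning

cost : Letter → Letter → ℕ
cost a a = 0
cost a b = 1
cost b a = 1
cost b b = 0

cost-refl : ∀ c → cost c c ≡ 0
cost-refl a = refl
cost-refl b = refl

cost≤1 : ∀ c x → cost c x ≤ 1
cost≤1 a a = z≤n
cost≤1 a b = ≤-refl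
cost≤1 b a = ≤-refl
cost≤1 b b = z≤n

cost≡0⇒≡ : ∀ c x → cost c x ≡ 0 → x ≡ c
cost≡0⇒≡ a a _ = refl
cost≡0⇒≡ b b _ = refl

cost-swap : ∀ c x → cost (swap c) (swap x) ≡ cost c x
cost-swap a a = refl
cost-swap a b = refl
cost-swap b a = refl
cost-swap b b = refl

swap-involutive : ∀ x → swap (swap x) ≡ x
swap-involutive a = refl
swap-involutive b = refl

⊥ʷ-involutive : ∀ u → (u ⊥ʷ) ⊥ʷ ≡ u
⊥ʷ-involutive u = trans (sym (map-∘ u)) (trans (map-cong swap-involutive u) (map-id u))

changes : Letter → List Letter → ℕ
changes c []      = 0
changes c (x ∷ u) = cost c x + changes x u

final : Letter → List Letter → Letter
final c []      = c
final c (x ∷ u) = final x u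

changes-⊥ʷ : ∀ c u → changes (swap c) (u ⊥ʷ) ≡ changes c u
changes-⊥ʷ c []      = refl
changes-⊥ʷ c (x ∷ u) = cong₂ _+_ (cost-swap c x) (changes-⊥ʷ x u)

changes-replicate-++ : ∀ c k v → changes c (replicate k c ++ v) ≡ changes c v
changes-replicate-++ c zero    v = refl
changes-replicate-++ c (suc k) v =
  cong₂ _+_ (cost-refl c) (changes-replicate-++ c k v)

B⇒changes : ∀ {n u} → B n u → changes a u < n
B⇒changes (aᵏ k) = s≤s (≤-trans (≤-reflexive (begin
  changes a (replicate k a)       ≡⟨ cong (changes a) (++-identityʳ (replicate k a)) ⟨
  changes a (replicate k a ++ []) ≡⟨ changes-replicate-++ a k [] ⟩
  0                               ∎)) z≤n)
B⇒changes (aᵏb⊥ k u p) = s≤s (≤-trans (≤-reflexive (begin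
  changes a (replicate k a ++ b ∷ u ⊥ʷ) ≡⟨ changes-replicate-++ a k _ ⟩
  suc (changes b (u ⊥ʷ))                ≡⟨ cong suc (changes-⊥ʷ a u) ⟩
  suc (changes a u)                     ∎)) (B⇒changes p))

B-mono : ∀ {n u} → B n u → B (suc n) u
B-mono (aᵏ k)       = aᵏ k
B-mono (aᵏb⊥ k u p) = aᵏb⊥ k u (B-mono p)

B-prepend-a : ∀ {n v} → B (suc n) v → B (suc n) (a ∷ v)
B-prepend-a (aᵏ k)       = aᵏ (suc k)
B-prepend-a (aᵏb⊥ k u p) = aᵏb⊥ (suc k) u p

mutual
  changes⇒B : ∀ {n} u → changes a u < n → B n u
  changes⇒B []      (s≤s _)   = aᵏ 0
  changes⇒B (a ∷ u) h@(s≤s _) = B-prepend-a (changes⇒B u h)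
  changes⇒B (b ∷ u) (s≤s h)   =
    subst (λ v → B _ (b ∷ v)) (⊥ʷ-involutive u) (aᵏb⊥ 0 (u ⊥ʷ) (changes⇒B⊥ʷ u h))

  changes⇒B⊥ʷ : ∀ {n} u → changes b u < n → B n (u ⊥ʷ)
  changes⇒B⊥ʷ []      (s≤s _)   = aᵏ 0
  changes⇒B⊥ʷ (b ∷ u) h@(s≤s _) = B-prepend-a (changes⇒B⊥ʷ u h)
  changes⇒B⊥ʷ (a ∷ u) (s≤s h)   = aᵏb⊥ 0 u (changes⇒B u h)

infixr 5 _⊕_

_⊕_ : List Letter → Word∞ → Word∞
([] ⊕ v) i          = v i
((x ∷ u) ⊕ v) zero    = x
((x ∷ u) ⊕ v) (suc i) = (u ⊕ v) i

prefix-⊕ : ∀ u v → prefix (u ⊕ v) (length u) ≡ u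
prefix-⊕ []      v = refl
prefix-⊕ (x ∷ u) v = cong (x ∷_) (prefix-⊕ u v)

⊕-at-length : ∀ u v → (u ⊕ v) (length u) ≡ v 0
⊕-at-length []      v = refl
⊕-at-length (x ∷ u) v = ⊕-at-length u v

changes-prefix-⊕ : ∀ c u v {m} → (∀ k → changes (final c u) (prefix v k) ≤ m) →
                   ∀ k → changes c (prefix (u ⊕ v) k) ≤ changes c u + m
changes-prefix-⊕ c []      v     h k       = h k
changes-prefix-⊕ c (x ∷ u) v     h zero    = z≤n
changes-prefix-⊕ c (x ∷ u) v {m} h (suc k) =
  ≤-trans (+-monoʳ-≤ (cost c x) (changes-prefix-⊕ x u v h k))
          (≤-reflexive (sym (+-assoc (cost c x) (changes x u) m)))

changes-prefix-const-self : ∀ x k → changes x (prefix (const x) k) ≡ 0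
changes-prefix-const-self x zero    = refl
changes-prefix-const-self x (suc k) =
  cong₂ _+_ (cost-refl x) (changes-prefix-const-self x k)

changes-prefix-const : ∀ c x k → changes c (prefix (const x) k) ≤ 1
changes-prefix-const c x zero    = z≤n
changes-prefix-const c x (suc k) = ≤-trans (≤-reflexive (begin
  cost c x + changes x (prefix (const x) k)
    ≡⟨ cong (cost c x +_) (changes-prefix-const-self x k) ⟩
  cost c x + 0
    ≡⟨ +-identityʳ (cost c x) ⟩
  cost c x
    ∎)) (cost≤1 c x)

not-isolated : ∀ {n w} → [ B n ] w → ¬ IsolatedIn [ B (suc n) ] w
not-isolated {n} {w} w∈ (_ , N , isolated) = a≢b (begin
  a                        ≡⟨ ⊕-at-length u (const a) ⟨
  (u ⊕ const a) (length u) ≡⟨ isolated _ (extension∈ a) (extension-agrees a) (length u) ⟩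
  w (length u)             ≡⟨ isolated _ (extension∈ b) (extension-agrees b) (length u) ⟨
  (u ⊕ const b) (length u) ≡⟨ ⊕-at-length u (const b) ⟩
  b                        ∎)
  where
  u : List Letter
  u = prefix w N

  a≢b : a ≢ b
  a≢b ()

  extension∈ : ∀ x → [ B (suc n) ] (u ⊕ const x)
  extension∈ x k = changes⇒B _ (s≤s (≤-trans
    (changes-prefix-⊕ a u (const x) (changes-prefix-const (final a u) x) k)
    (≤-trans (≤-reflexive (+-comm (changes a u) 1)) (B⇒changes (w∈ N)))))

  extension-agrees : ∀ x → prefix (u ⊕ const x) N ≡ u
  extension-agrees x =
    subst (λ k → prefix (u ⊕ const x) k ≡ u) (length-applyUpTo w N) (prefix-⊕ u (const x))

Saturated : Letter → Word∞ → ℕ → Set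
Saturated c w m = ∀ k → changes c (prefix w k) ≤ changes c (prefix w m)

continuation : Letter → List Letter → Word∞
continuation c u = u ⊕ const (final c u)

unchanging⇒constant : ∀ c w → (∀ k → changes c (prefix w k) ≤ 0) → w ≈ω const c
unchanging⇒constant c w h zero    =
  cost≡0⇒≡ c (w 0) (n≤0⇒n≡0 (m+n≤o⇒m≤o (cost c (w 0)) (h 1)))
unchanging⇒constant c w h (suc i) = trans
  (unchanging⇒constant (w 0) (w ∘ suc) (λ k → m+n≤o⇒n≤o (cost c (w 0)) (h (suc k))) i)
  (unchanging⇒constant c w h zero)

saturated⇒continuation : ∀ c w m → Saturated c w m → w ≈ω continuation c (prefix w m)
saturated⇒continuation c w zero    h         = unchanging⇒constant c w h
saturated⇒continuation c w (suc m) h zero    = refl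
saturated⇒continuation c w (suc m) h (suc i) =
  saturated⇒continuation (w 0) (w ∘ suc) m
    (λ k → +-cancelˡ-≤ (cost c (w 0)) _ _ (h (suc k))) i

saturated⇒isolated : ∀ {n w} m → [ B (suc n) ] w → n ≤ changes a (prefix w m) →
                     IsolatedIn [ B (suc n) ] w
saturated⇒isolated {n} {w} m w∈ n≤ = w∈ , m , λ y y∈ y|m≡w|m i → begin
  y i                           ≡⟨ saturated⇒continuation a y m (saturated-y y∈ y|m≡w|m) i ⟩
  continuation a (prefix y m) i ≡⟨ cong (λ u → continuation a u i) y|m≡w|m ⟩
  continuation a (prefix w m) i ≡⟨ saturated⇒continuation a w m saturated-w i ⟨
  w i                           ∎
  where
  bounded : ∀ {v} → [ B (suc n) ] v → ∀ k → changes a (prefix v k) ≤ n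
  bounded v∈ k = s≤s⁻¹ (B⇒changes (v∈ k))

  saturated-w : Saturated a w m
  saturated-w k = ≤-trans (bounded w∈ k) n≤

  saturated-y : ∀ {y} → [ B (suc n) ] y → prefix y m ≡ prefix w m → Saturated a y m
  saturated-y y∈ y|m≡w|m k =
    ≤-trans (bounded y∈ k) (subst (n ≤_) (cong (changes a) (sym y|m≡w|m)) n≤)

mainTheorem20 : (n : ℕ) → ([ B (suc n) ] ′) ≐ [ B n ]
mainTheorem20 n w = derived⇒B , B⇒derived
  where
  derived⇒B : ([ B (suc n) ] ′) w → [ B n ] w
  derived⇒B (w∈ , ¬isolated) k = changes⇒B (prefix w k)
    (decidable-stable (changes a (prefix w k) <? n)
      (λ ≮ → ¬isolated (saturated⇒isolated k w∈ (≮⇒≥ ≮))))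

  B⇒derived : [ B n ] w → ([ B (suc n) ] ′) w
  B⇒derived w∈ = B-mono ∘ w∈ , not-isolated w∈
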